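{- Let $d\geq 2$ and $\mathbf{k}=(k_1,\dots,k_{d+1})$ positive integers. The quotient $\Lambda_d/L_{\mathbf{k}}$ is finite; its number of elements equals the number of full-dimensional faces of the Heawood complex $H_{\mathbf{k}}$, and \[ |\Lambda_d/L_{\mathbf{k}}|=\det M_{\mathbf{k}}=\prod_{i=1}^{d+1}(k_i+1)-\prod_{i=1}^{d+1}k_i. \]
   Context: Let $e_1,\dots,e_{d+1}$ be the standard basis of $\mathbb{R}^{d+1}$, $w_i=(d+1)e_i-\sum_je_j$, and $\Lambda_d=\{\sum a_iw_i: a_i\in\mathbb{Z}\}$. $M_{\mathbf{k}}$ is the $(d+1)\times(d+1)$ integer matrix whose $i$-th row has entry $k_i+1$ in column $i$, entry $-k_{i+1}$ in column $i+1$ (indices cyclic mod $d+1$), zeros elsewhere. $L_{\mathbf{k}}=\{\sum a_iw_i: a=bM_{\mathbf{k}},\ b\in\mathbb{Z}^{d+1}\}$. $\mathrm{Perm}_d=\operatorname{conv}\{(\sigma(1),\dots,\sigma(d+1)):\sigma\in\mathfrak S_{d+1}\}$. The permutahedral tiling $\mathcal P_d$ is the polytopal complex consisting of the tiles $\mathrm{Perm}_d+v$, $v\in\Lambda_d$, and all their faces; it tiles the hyperplane $\sum x_i=1+\dots+(d+1)$. The Heawood complex $H_{\mathbf{k}}$ is the complex whose faces are the equivalence classes of faces of $\mathcal P_d$ under translation by vectors in $L_{\mathbf{k}}$, a class contained in another if some representative of the first is contained in some representative of the second. -}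

module Defs where

open import Data.Nat as ℕ using (ℕ; zero; suc)
open import Data.Nat.DivMod using (_%_; m%n<n)
open import Data.Integer as ℤ using (ℤ; +_; -_)
open import Data.Rational as ℚ using (ℚ; 0ℚ; 1ℚ)
open import Data.Fin using (Fin; zero; suc; toℕ; fromℕ<; punchIn; _≟_)
open import Data.Fin.Permutation using (Permutation′; _⟨$⟩ʳ_)
open import Data.List using (List; []; _∷_)
open import Data.List.Relation.Unary.All using (All)
open import Data.Product using (Σ; ∃; _×_; _,_)
open import Relation.Binary.PropositionalEquality using (_≡_)
open import Relation.Nullary using (yes; no)
open import Function.Bundles using (_⇔_)

sumℤ : ∀ {n} → (Fin n → ℤ) → ℤ
sumℤ {zero}  f = + 0
sumℤ {suc n} f = f zero ℤ.+ sumℤ (λ i → f (suc i))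

prodℤ : ∀ {n} → (Fin n → ℤ) → ℤ
prodℤ {zero}  f = + 1
prodℤ {suc n} f = f zero ℤ.* prodℤ (λ i → f (suc i))

signℤ : ℕ → ℤ
signℤ zero          = + 1
signℤ (suc zero)    = - (+ 1)
signℤ (suc (suc m)) = signℤ m

det : ∀ {n} → (Fin n → Fin n → ℤ) → ℤ
det {zero}  A = + 1
det {suc n} A =
  sumℤ (λ j → signℤ (toℕ j) ℤ.* (A zero j ℤ.* det (λ r c → A (suc r) (punchIn j c))))

cyc : ∀ {d} → Fin (suc d) → Fin (suc d)
cyc {d} i = fromℕ< (m%n<n (suc (toℕ i)) (suc d))

δℤ : ∀ {n} → Fin n → Fin n → ℤ
δℤ i j with i ≟ j
... | yes _ = + 1
... | no  _ = + 0

w : ∀ d → Fin (suc d) → Fin (suc d) → ℤ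
w d i j = (+ suc d) ℤ.* δℤ i j ℤ.- + 1

M : ∀ d → (Fin (suc d) → ℕ) → Fin (suc d) → Fin (suc d) → ℤ
M d k i j with j ≟ i
... | yes _ = + (suc (k i))
... | no  _ with j ≟ cyc i
...   | yes _ = - (+ k (cyc i))
...   | no  _ = + 0

combW : ∀ d → (Fin (suc d) → ℤ) → Fin (suc d) → ℤ
combW d a j = sumℤ (λ i → a i ℤ.* w d i j)

InΛ : ∀ d → (Fin (suc d) → ℤ) → Set
InΛ d x = ∃ λ (a : Fin (suc d) → ℤ) → ∀ j → x j ≡ combW d a j

vecMat : ∀ d → (Fin (suc d) → ℤ) → (Fin (suc d) → Fin (suc d) → ℤ) → Fin (suc d) → ℤ
vecMat d b A i = sumℤ (λ l → b l ℤ.* A l i)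

InL : ∀ d → (Fin (suc d) → ℕ) → (Fin (suc d) → ℤ) → Set
InL d k x = ∃ λ (b : Fin (suc d) → ℤ) → ∀ j → x j ≡ combW d (vecMat d b (M d k)) j

CongL : ∀ d → (Fin (suc d) → ℕ) → (Fin (suc d) → ℤ) → (Fin (suc d) → ℤ) → Set
CongL d k x y = InL d k (λ j → x j ℤ.- y j)

HasNClasses : {A : Set} → (A → Set) → (A → A → Set) → ℕ → Set
HasNClasses {A} P _~_ N =
  Σ (Fin N → A) λ r →
    (∀ i → P (r i)) ×
    (∀ i j → r i ~ r j → i ≡ j) ×
    (∀ x → P x → ∃ λ i → x ~ r i)

ℤ→ℚ : ℤ → ℚ
ℤ→ℚ z = z ℚ./ 1

vertex : ∀ d → Permutation′ (suc d) → Fin (suc d) → ℚ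
vertex d σ j = ℤ→ℚ (+ suc (toℕ (σ ⟨$⟩ʳ j)))

-- a finite formal convex combination of vertices
Comb : ℕ → Set
Comb d = List (ℚ × Permutation′ (suc d))

weightSum : ∀ {d} → Comb d → ℚ
weightSum []             = 0ℚ
weightSum ((l , _) ∷ cs) = l ℚ.+ weightSum cs

combPoint : ∀ {d} → Comb d → Fin (suc d) → ℚ
combPoint []             j = 0ℚ
combPoint {d} ((l , σ) ∷ cs) j = l ℚ.* vertex d σ j ℚ.+ combPoint cs j

NonNegW : ∀ {d} → ℚ × Permutation′ (suc d) → Set
NonNegW (l , _) = 0ℚ ℚ.≤ l

InPerm : ∀ d → (Fin (suc d) → ℚ) → Set
InPerm d x = ∃ λ (cs : Comb d) →
  All NonNegW cs × weightSum cs ≡ 1ℚ × (∀ j → x j ≡ combPoint cs j)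

InTile : ∀ d → (Fin (suc d) → ℤ) → (Fin (suc d) → ℚ) → Set
InTile d v x = InPerm d (λ j → x j ℚ.- ℤ→ℚ (v j))

-- two tiles Perm_d + v, Perm_d + v′ are identified in H_k iff
-- (Perm_d + v) + ℓ = Perm_d + v′ for some ℓ ∈ L_k
TileEquiv : ∀ d → (Fin (suc d) → ℕ) → (Fin (suc d) → ℤ) → (Fin (suc d) → ℤ) → Set
TileEquiv d k v v′ = ∃ λ (ℓ : Fin (suc d) → ℤ) → InL d k ℓ ×
  (∀ x → InTile d v x ⇔ InTile d v′ (λ j → x j ℚ.+ ℤ→ℚ (ℓ j)))

-- the full-dimensional faces of the permutahedral tiling P_d are the
-- tiles Perm_d + v (v ∈ Λ_d); the full-dimensional faces of H_k are their
-- classes under TileEquiv.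

-- Points of Λ_d are the vectors combW a, and a is determined by its image up to adding a constant;
-- since the columns of M_k sum to 1, constants are themselves of the form b M_k.  So Λ_d / L_k is
-- ℤ^{d+1} modulo the rows of M_k, and each class contains exactly one normal form: a vector e with
-- 0 ≤ e_j ≤ k_j and some e_j = 0.  A representative with 0 ≤ e_j ≤ k_j comes from solving the cyclic
-- system b_j = ⌊(a_j + k_j b_{j-1}) / (k_j + 1)⌋ by a monotone fixed-point argument, and subtracting
-- min e creates the zero.  If two normal forms differ by s M_k, a positive maximum of s propagates
-- around the cycle and contradicts the bounds, so s = 0.  Counting normal forms gives
-- ∏ (k_i + 1) − ∏ k_i, which Laplace expansion along the first row identifies with det M_k.
-- Finally the tile Perm_d + v translated by ℓ is Perm_d + v′ exactly when v′ = v + ℓ, as the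
-- minimal coordinates of the points of a tile show, so tiles modulo L_k are again Λ_d / L_k.
module Submission where

open import Defs
open import Data.Empty using (⊥-elim)
open import Data.Fin using (Fin; zero; suc; toℕ; fromℕ; fromℕ<; inject₁; punchIn; _≟_)
open import Data.Fin.Induction using (<-weakInduction; >-weakInduction)
open import Data.Fin.Permutation using (_⟨$⟩ʳ_; transpose)
open import Data.Fin.Properties
  using (toℕ-injective; suc-injective; toℕ-fromℕ; toℕ-inject₁; toℕ<n; toℕ-fromℕ<; +↔⊎; *↔×)
open import Data.Integer
  using (ℤ; +_; -_; -[1+_]; ∣_∣; _+_; _*_; _-_; _≤_; _<_; +≤+; +<+; nonNegative)
open import Data.Integer.DivMod using (_/ℕ_; _%ℕ_; a≡a%ℕn+[a/ℕn]*n; n%ℕd<d; [n/ℕd]*d≤n; n<s[n/ℕd]*d)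
import Data.Integer.Properties as ℤP
open import Data.Integer.Tactic.RingSolver using (solve-∀)
import Data.List as List
open import Data.List.Relation.Unary.All as All using (All)
open import Data.Nat as ℕ using (ℕ; zero; suc; s≤s; z≤n)
open import Data.Nat.Coprimality as Cop using (Coprime; 1-coprimeTo)
open import Data.Nat.DivMod using (m%n<n; m<n⇒m%n≡m; n%n≡0)
import Data.Nat.Properties as ℕP
open import Data.Product using (Σ; _×_; _,_; proj₁; proj₂; ∃)
open import Data.Rational as ℚ using (ℚ; mkℚ; 1ℚ; *≤*)
import Data.Rational.Properties as ℚP
open import Data.Sum using (_⊎_; inj₁; inj₂; [_,_]′)
open import Data.Vec.Functional using (Vector; head; tail; _∷_)
open import Function using (_∘_; id; _↔_; Inverse; _⇔_; Equivalence; mk⇔)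
open import Relation.Binary.Core using (_Preserves_⟶_)
open import Relation.Binary.Definitions using (Reflexive; Symmetric; Transitive; Total)
open import Relation.Binary.PropositionalEquality
open import Relation.Nullary using (yes; no; ¬_)
open import Relation.Unary using (_∪_; _≐_)

sumℤ-cong : ∀ {n} {f g : Fin n → ℤ} → f ≗ g → sumℤ f ≡ sumℤ g
sumℤ-cong {zero}  f≗g = refl
sumℤ-cong {suc n} f≗g = cong₂ _+_ (f≗g zero) (sumℤ-cong (f≗g ∘ suc))

prodℤ-cong : ∀ {n} {f g : Fin n → ℤ} → f ≗ g → prodℤ f ≡ prodℤ g
prodℤ-cong {zero}  f≗g = refl
prodℤ-cong {suc n} f≗g = cong₂ _*_ (f≗g zero) (prodℤ-cong (f≗g ∘ suc))

sumℤ-zero : ∀ {n} {f : Fin n → ℤ} → (∀ i → f i ≡ + 0) → sumℤ f ≡ + 0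
sumℤ-zero {zero}  f≡0 = refl
sumℤ-zero {suc n} f≡0 = cong₂ _+_ (f≡0 zero) (sumℤ-zero (f≡0 ∘ suc))

sumℤ-single : ∀ {n} {f : Fin n → ℤ} p → (∀ i → i ≢ p → f i ≡ + 0) → sumℤ f ≡ f p
sumℤ-single {suc n} {f} zero    f≡0 =
  trans (cong (_+_ (f zero)) (sumℤ-zero (λ i → f≡0 (suc i) λ ()))) (ℤP.+-identityʳ (f zero))
sumℤ-single {suc n} {f} (suc p) f≡0 =
  trans (cong₂ _+_ (f≡0 zero λ ()) (sumℤ-single p (λ i i≢p → f≡0 (suc i) (i≢p ∘ suc-injective))))
        (ℤP.+-identityˡ (f (suc p)))

sumℤ-pair : ∀ {n} {f : Fin n → ℤ} p q → p ≢ q → (∀ i → i ≢ p → i ≢ q → f i ≡ + 0) →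
            sumℤ f ≡ f p + f q
sumℤ-pair {suc n}     zero    zero    p≢q f≡0 = ⊥-elim (p≢q refl)
sumℤ-pair {suc n} {f} zero    (suc q) p≢q f≡0 =
  cong (_+_ (f zero)) (sumℤ-single q (λ i i≢q → f≡0 (suc i) (λ ()) (i≢q ∘ suc-injective)))
sumℤ-pair {suc n} {f} (suc p) zero    p≢q f≡0 =
  trans (cong (_+_ (f zero)) (sumℤ-single p (λ i i≢p → f≡0 (suc i) (i≢p ∘ suc-injective) (λ ()))))
        (ℤP.+-comm (f zero) (f (suc p)))
sumℤ-pair {suc n} {f} (suc p) (suc q) p≢q f≡0 =
  trans (cong₂ _+_ (f≡0 zero (λ ()) (λ ()))
                   (sumℤ-pair p q (p≢q ∘ cong suc)
                      (λ i i≢p i≢q → f≡0 (suc i) (i≢p ∘ suc-injective) (i≢q ∘ suc-injective))))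
        (ℤP.+-identityˡ (f (suc p) + f (suc q)))

sumℤ-neg : ∀ {n} (f : Fin n → ℤ) → sumℤ (λ i → - f i) ≡ - sumℤ f
sumℤ-neg {zero}  f = refl
sumℤ-neg {suc n} f =
  trans (cong (_+_ (- f zero)) (sumℤ-neg (f ∘ suc))) (sym (ℤP.neg-distrib-+ (f zero) (sumℤ (f ∘ suc))))

sumℤ-+ : ∀ {n} (f g : Fin n → ℤ) → sumℤ (λ i → f i + g i) ≡ sumℤ f + sumℤ g
sumℤ-+ {zero}  f g = refl
sumℤ-+ {suc n} f g =
  trans (cong (_+_ (f zero + g zero)) (sumℤ-+ (f ∘ suc) (g ∘ suc)))
        (interchange (f zero) (g zero) (sumℤ (f ∘ suc)) (sumℤ (g ∘ suc)))
  where
  interchange : ∀ a b c e → a + b + (c + e) ≡ a + c + (b + e)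
  interchange = solve-∀

sumℤ-*ˡ : ∀ {n} c (f : Fin n → ℤ) → sumℤ (λ i → c * f i) ≡ c * sumℤ f
sumℤ-*ˡ {zero}  c f = sym (ℤP.*-zeroʳ c)
sumℤ-*ˡ {suc n} c f =
  trans (cong (_+_ (c * f zero)) (sumℤ-*ˡ c (f ∘ suc))) (sym (ℤP.*-distribˡ-+ c (f zero) (sumℤ (f ∘ suc))))

cyc⁻¹ : ∀ {d} → Fin (suc d) → Fin (suc d)
cyc⁻¹ {d} zero    = fromℕ d
cyc⁻¹     (suc i) = inject₁ i

cyc-inject₁ : ∀ {d} (i : Fin d) → cyc (inject₁ i) ≡ suc i
cyc-inject₁ {d} i = toℕ-injective (begin
  toℕ (cyc (inject₁ i))              ≡⟨ toℕ-fromℕ< (m%n<n (suc (toℕ (inject₁ i))) (suc d)) ⟩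
  suc (toℕ (inject₁ i)) ℕ.% suc d    ≡⟨ cong (λ m → suc m ℕ.% suc d) (toℕ-inject₁ i) ⟩
  suc (toℕ i) ℕ.% suc d              ≡⟨ m<n⇒m%n≡m (s≤s (toℕ<n i)) ⟩
  suc (toℕ i)                        ∎)
  where open ≡-Reasoning

cyc-fromℕ : ∀ d → cyc (fromℕ d) ≡ zero
cyc-fromℕ d = toℕ-injective (begin
  toℕ (cyc (fromℕ d))                ≡⟨ toℕ-fromℕ< (m%n<n (suc (toℕ (fromℕ d))) (suc d)) ⟩
  suc (toℕ (fromℕ d)) ℕ.% suc d      ≡⟨ cong (λ m → suc m ℕ.% suc d) (toℕ-fromℕ d) ⟩
  suc d ℕ.% suc d                    ≡⟨ n%n≡0 (suc d) ⟩
  0                                  ∎)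
  where open ≡-Reasoning

cyc-cyc⁻¹ : ∀ {d} (j : Fin (suc d)) → cyc (cyc⁻¹ j) ≡ j
cyc-cyc⁻¹ {d} zero = cyc-fromℕ d
cyc-cyc⁻¹ (suc i)  = cyc-inject₁ i

cyc⁻¹-cyc : ∀ {d} (i : Fin (suc d)) → cyc⁻¹ (cyc i) ≡ i
cyc⁻¹-cyc {d} = >-weakInduction (λ i → cyc⁻¹ (cyc i) ≡ i)
  (cong cyc⁻¹ (cyc-fromℕ d)) (λ i _ → cong cyc⁻¹ (cyc-inject₁ i))

cyc⁻¹-irrefl : ∀ {d} (i : Fin (suc (suc d))) → cyc⁻¹ i ≢ i
cyc⁻¹-irrefl zero    ()
cyc⁻¹-irrefl (suc i) e = ℕP.1+n≢n (trans (cong toℕ (sym e)) (toℕ-inject₁ i))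

M-diag : ∀ {d} k (i : Fin (suc d)) → M d k i i ≡ + suc (k i)
M-diag k i with i ≟ i
... | yes _  = refl
... | no i≢i = ⊥-elim (i≢i refl)

M-cyc⁻¹ : ∀ {d} k (j : Fin (suc (suc d))) → M (suc d) k (cyc⁻¹ j) j ≡ - + k j
M-cyc⁻¹ k j with j ≟ cyc⁻¹ j
... | yes e = ⊥-elim (cyc⁻¹-irrefl j (sym e))
... | no _ with j ≟ cyc (cyc⁻¹ j)
...   | yes _ = cong (λ i → - + k i) (cyc-cyc⁻¹ j)
...   | no ne = ⊥-elim (ne (sym (cyc-cyc⁻¹ j)))

M-zero : ∀ {d} k (i j : Fin (suc d)) → j ≢ i → i ≢ cyc⁻¹ j → M d k i j ≡ + 0
M-zero k i j j≢i i≢cyc⁻¹j with j ≟ i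
... | yes e = ⊥-elim (j≢i e)
... | no _ with j ≟ cyc i
...   | yes e = ⊥-elim (i≢cyc⁻¹j (trans (sym (cyc⁻¹-cyc i)) (cong cyc⁻¹ (sym e))))
...   | no _  = refl

minor : ∀ {n} → (Fin (suc n) → Fin (suc n) → ℤ) → Fin (suc n) → Fin n → Fin n → ℤ
minor A j r c = A (suc r) (punchIn j c)

laplaceTerm : ∀ {n} → (Fin (suc n) → Fin (suc n) → ℤ) → Fin (suc n) → ℤ
laplaceTerm A j = signℤ (toℕ j) * (A zero j * det (minor A j))

laplaceTerm-zeroEntry : ∀ {n} (A : Fin (suc n) → Fin (suc n) → ℤ) j →
                        A zero j ≡ + 0 → laplaceTerm A j ≡ + 0
laplaceTerm-zeroEntry A j A≡0 rewrite A≡0 = ℤP.*-zeroʳ (signℤ (toℕ j))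

laplaceTerm-zeroMinor : ∀ {n} (A : Fin (suc n) → Fin (suc n) → ℤ) j →
                        det (minor A j) ≡ + 0 → laplaceTerm A j ≡ + 0
laplaceTerm-zeroMinor A j det≡0 rewrite det≡0 =
  trans (cong (signℤ (toℕ j) *_) (ℤP.*-zeroʳ (A zero j))) (ℤP.*-zeroʳ (signℤ (toℕ j)))

det-firstRowSingle : ∀ {n} (A : Fin (suc n) → Fin (suc n) → ℤ) j → (∀ c → c ≢ j → A zero c ≡ + 0) →
                     det A ≡ laplaceTerm A j
det-firstRowSingle A j A≡0 =
  sumℤ-single {f = laplaceTerm A} j (λ c c≢j → laplaceTerm-zeroEntry A c (A≡0 c c≢j))

det-zeroColumn : ∀ {n} (A : Fin (suc n) → Fin (suc n) → ℤ) → (∀ r → A r zero ≡ + 0) → det A ≡ + 0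
laplaceTerm-zeroColumn : ∀ {n} (A : Fin (suc n) → Fin (suc n) → ℤ) j → (∀ r → A (suc r) zero ≡ + 0) →
                         laplaceTerm A (suc j) ≡ + 0

det-zeroColumn A A≡0 = sumℤ-zero {f = laplaceTerm A} λ
  { zero    → laplaceTerm-zeroEntry A zero (A≡0 zero)
  ; (suc j) → laplaceTerm-zeroColumn A j (A≡0 ∘ suc) }
laplaceTerm-zeroColumn {suc n} A j A≡0 =
  laplaceTerm-zeroMinor A (suc j) (det-zeroColumn (minor A (suc j)) A≡0)

det-upperTriangular : ∀ {n} (A : Fin n → Fin n → ℤ) → (∀ r c → toℕ c ℕ.< toℕ r → A r c ≡ + 0) →
                      det A ≡ prodℤ (λ i → A i i)
det-upperTriangular {zero}  A A≡0 = refl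
det-upperTriangular {suc n} A A≡0 = begin
  det A                                    ≡⟨ sumℤ-single {f = laplaceTerm A} zero offDiagonal≡0 ⟩
  + 1 * (A zero zero * det (minor A zero)) ≡⟨ ℤP.*-identityˡ _ ⟩
  A zero zero * det (minor A zero)         ≡⟨ cong (A zero zero *_) (det-upperTriangular (minor A zero) minor₀≡0) ⟩
  prodℤ (λ i → A i i)                      ∎
  where
  open ≡-Reasoning
  offDiagonal≡0 : ∀ j → j ≢ zero → laplaceTerm A j ≡ + 0
  offDiagonal≡0 zero    j≢0 = ⊥-elim (j≢0 refl)
  offDiagonal≡0 (suc j) _   = laplaceTerm-zeroColumn A j λ r → A≡0 (suc r) zero (s≤s z≤n)
  minor₀≡0 : ∀ r c → toℕ c ℕ.< toℕ r → minor A zero r c ≡ + 0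
  minor₀≡0 r c c<r = A≡0 (suc r) (suc c) (s≤s c<r)

-- Nonzero entries only on the superdiagonal, on the diagonal below row 0 and in the bottom left corner.
CornerBidiagonal : ∀ m → (Fin (suc m) → Fin (suc m) → ℤ) → Set
CornerBidiagonal m X = ∀ r c → toℕ c ≢ suc (toℕ r) → (toℕ c ≡ toℕ r → toℕ r ≡ 0) →
                       (toℕ r ≡ m → toℕ c ≢ 0) → X r c ≡ + 0

det-cornerBidiagonal : ∀ m (X : Fin (suc m) → Fin (suc m) → ℤ) (p : Fin m → ℤ) z →
                       CornerBidiagonal m X →
                       (∀ r → X (inject₁ r) (suc r) ≡ p r) → X (fromℕ m) zero ≡ z →
                       det X ≡ prodℤ (λ r → - p r) * z
det-cornerBidiagonal zero X p z shape super corner =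
  trans (cong (λ x → + 1 * (x * + 1) + + 0) corner) (base z)
  where
  base : ∀ z → + 1 * (z * + 1) + + 0 ≡ + 1 * z
  base = solve-∀
det-cornerBidiagonal (suc m) X p z shape super corner = begin
  det X                                                  ≡⟨ det-firstRowSingle X (suc zero) firstRow≡0 ⟩
  - + 1 * (X zero (suc zero) * det (minor X (suc zero))) ≡⟨ cong₂ (λ x y → - + 1 * (x * y)) (super zero) minor≡ ⟩
  - + 1 * (p zero * (prodℤ (λ r → - p (suc r)) * z))     ≡⟨ reassoc (p zero) _ z ⟩
  prodℤ (λ r → - p r) * z                                ∎
  where
  open ≡-Reasoning
  reassoc : ∀ a b c → - + 1 * (a * (b * c)) ≡ - a * b * c
  reassoc = solve-∀
  firstRow≡0 : ∀ c → c ≢ suc zero → X zero c ≡ + 0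
  firstRow≡0 c c≢1 = shape zero c (c≢1 ∘ toℕ-injective) (λ _ → refl) (λ ())
  minorShape : CornerBidiagonal m (minor X (suc zero))
  minorShape r zero    _   _        r≡m⇒c≢0 =
    shape (suc r) zero (λ ()) (λ ()) (λ r≡m → ⊥-elim (r≡m⇒c≢0 (ℕP.suc-injective r≡m) refl))
  minorShape r (suc c) c≢r+1 c≡r⇒r≡0 _ =
    shape (suc r) (suc (suc c)) (c≢r+1 ∘ ℕP.suc-injective) c+2≢r+1 (λ _ ())
    where
    c+2≢r+1 : suc (suc (toℕ c)) ≡ suc (toℕ r) → suc (toℕ r) ≡ 0
    c+2≢r+1 e = let c+1≡r = ℕP.suc-injective e in
      ⊥-elim (ℕP.0≢1+n (trans (sym (c≡r⇒r≡0 c+1≡r)) (sym c+1≡r)))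
  minor≡ : det (minor X (suc zero)) ≡ prodℤ (λ r → - p (suc r)) * z
  minor≡ = det-cornerBidiagonal m (minor X (suc zero)) (p ∘ suc) z minorShape (super ∘ suc) corner

-- Row 0 of M_k has two nonzero entries; deleting column 0 leaves an upper triangular minor with diagonal
-- k₁ + 1, …, k_d + 1, deleting column 1 a corner-bidiagonal one with superdiagonal -k₂, …, -k_d and corner -k₀.
det-M : ∀ d₀ (k : Fin (suc (suc (suc d₀))) → ℕ) →
        det (M (suc (suc d₀)) k) ≡ prodℤ (λ i → + suc (k i)) - prodℤ (λ i → + k i)
det-M d₀ k = begin
  det Mₖ                                           ≡⟨ sumℤ-pair {f = laplaceTerm Mₖ} zero (suc zero) (λ ()) firstRow≡0 ⟩
  laplaceTerm Mₖ zero + laplaceTerm Mₖ (suc zero)  ≡⟨ cong₂ _+_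
                                                        (cong₂ (λ a b → + 1 * (a * b)) (M-diag k zero) det-minor₀)
                                                        (cong₂ (λ a b → - + 1 * (a * b)) (M-cyc⁻¹ k (suc zero)) det-minor₁) ⟩
  + 1 * (k₀+1 * P) + - + 1 * (- k₁ * (Q * - k₀))   ≡⟨ expand k₀+1 P k₀ k₁ Q ⟩
  k₀+1 * P - k₀ * (k₁ * Q)                         ∎
  where
  open ≡-Reasoning
  Mₖ = M (suc (suc d₀)) k
  k₀+1 = + suc (k zero)
  k₀ = + k zero
  k₁ = + k (suc zero)
  P = prodℤ (λ i → + suc (k (suc i)))
  Q = prodℤ (λ i → + k (suc (suc i)))
  expand : ∀ a P k₀ k₁ Q → + 1 * (a * P) + - + 1 * (- k₁ * (Q * - k₀)) ≡ a * P - k₀ * (k₁ * Q)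
  expand = solve-∀
  firstRow≡0 : ∀ i → i ≢ zero → i ≢ suc zero → laplaceTerm Mₖ i ≡ + 0
  firstRow≡0 zero          i≢0 _   = ⊥-elim (i≢0 refl)
  firstRow≡0 (suc zero)    _   i≢1 = ⊥-elim (i≢1 refl)
  firstRow≡0 (suc (suc j)) _   _   = laplaceTerm-zeroEntry Mₖ (suc (suc j)) (M-zero k zero (suc (suc j)) (λ ()) (λ ()))
  minor₀-upperTriangular : ∀ r c → toℕ c ℕ.< toℕ r → minor Mₖ zero r c ≡ + 0
  minor₀-upperTriangular r c c<r = M-zero k (suc r) (suc c) (ℕP.<⇒≢ c<r ∘ cong toℕ ∘ suc-injective)
    (λ e → ℕP.<-asym c<r (ℕP.≤-reflexive (trans (cong toℕ e) (toℕ-inject₁ c))))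
  det-minor₀ : det (minor Mₖ zero) ≡ P
  det-minor₀ = trans (det-upperTriangular (minor Mₖ zero) minor₀-upperTriangular) (prodℤ-cong (M-diag k ∘ suc))
  minor₁-cornerBidiagonal : CornerBidiagonal (suc d₀) (minor Mₖ (suc zero))
  minor₁-cornerBidiagonal r zero _ _ r≡m⇒c≢0 = M-zero k (suc r) zero (λ ())
    (λ e → r≡m⇒c≢0 (trans (cong toℕ (suc-injective e)) (toℕ-fromℕ (suc d₀))) refl)
  minor₁-cornerBidiagonal r (suc c) c≢r+1 c≡r⇒r≡0 _ = M-zero k (suc r) (suc (suc c))
    (λ e → let c+1≡r = cong toℕ (suc-injective e) in
           ℕP.0≢1+n (trans (sym (c≡r⇒r≡0 c+1≡r)) (sym c+1≡r)))
    (λ e → c≢r+1 (cong suc (trans (sym (toℕ-inject₁ c)) (cong toℕ (sym (suc-injective e))))))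
  det-minor₁ : det (minor Mₖ (suc zero)) ≡ Q * - k₀
  det-minor₁ = trans (det-cornerBidiagonal (suc d₀) (minor Mₖ (suc zero)) (λ r → - + k (suc (suc r))) (- k₀)
                        minor₁-cornerBidiagonal (λ r → M-cyc⁻¹ k (suc (suc r))) (M-cyc⁻¹ k zero))
               (cong (_* - k₀) (prodℤ-cong λ r → ℤP.neg-involutive (+ k (suc (suc r)))))

-- HasNClasses P _~_ N is Classes P _~_ (Fin N); other index sets let counts be built from sums and products.
Classes : {A : Set} → (A → Set) → (A → A → Set) → Set → Set
Classes {A} P _~_ I =
  Σ (I → A) λ r → (∀ i → P (r i)) × (∀ i j → r i ~ r j → i ≡ j) × (∀ x → P x → ∃ λ i → x ~ r i)

module _ {A : Set} {P : A → Set} (_~_ : A → A → Set) where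

  Classes-↔ : ∀ {I J} → I ↔ J → Classes P _~_ J → Classes P _~_ I
  Classes-↔ I↔J (r , P-r , r-inj , r-surj) =
    r ∘ to , P-r ∘ to , (λ i j ri~rj → to-injective (r-inj (to i) (to j) ri~rj)) , surj
    where
    open Inverse I↔J
    to-injective : ∀ {i j} → to i ≡ to j → i ≡ j
    to-injective {i} {j} e = trans (sym (strictlyInverseʳ i)) (trans (cong from e) (strictlyInverseʳ j))
    surj : ∀ x → P x → ∃ λ i → x ~ r (to i)
    surj x Px with r-surj x Px
    ... | j , x~rj = from j , subst (λ j → x ~ r j) (sym (strictlyInverseˡ j)) x~rj

  Classes-≐ : ∀ {Q I} → P ≐ Q → Classes P _~_ I → Classes Q _~_ I
  Classes-≐ (P⊆Q , Q⊆P) (r , P-r , r-inj , r-surj) = r , P⊆Q ∘ P-r , r-inj , λ x Qx → r-surj x (Q⊆P Qx)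

  Classes-⊎ : ∀ {Q I J} → Symmetric _~_ → (∀ {x y} → P x → Q y → ¬ x ~ y) →
              Classes P _~_ I → Classes Q _~_ J → Classes (P ∪ Q) _~_ (I ⊎ J)
  Classes-⊎ {Q} ~-sym P∩Q=∅ (r , P-r , r-inj , r-surj) (s , Q-s , s-inj , s-surj) =
    [ r , s ]′ , P∪Q-rs , inj , surj
    where
    P∪Q-rs : ∀ i → (P ∪ Q) ([ r , s ]′ i)
    P∪Q-rs (inj₁ i) = inj₁ (P-r i)
    P∪Q-rs (inj₂ j) = inj₂ (Q-s j)
    inj : ∀ i j → [ r , s ]′ i ~ [ r , s ]′ j → i ≡ j
    inj (inj₁ i) (inj₁ j) e = cong inj₁ (r-inj i j e)
    inj (inj₁ i) (inj₂ j) e = ⊥-elim (P∩Q=∅ (P-r i) (Q-s j) e)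
    inj (inj₂ i) (inj₁ j) e = ⊥-elim (P∩Q=∅ (P-r j) (Q-s i) (~-sym e))
    inj (inj₂ i) (inj₂ j) e = cong inj₂ (s-inj i j e)
    surj : ∀ x → (P ∪ Q) x → ∃ λ i → x ~ [ r , s ]′ i
    surj x (inj₁ Px) = let i , x~ri = r-surj x Px in inj₁ i , x~ri
    surj x (inj₂ Qx) = let j , x~sj = s-surj x Qx in inj₂ j , x~sj

  Classes-map : ∀ {B : Set} {Q : B → Set} {_≈_ : B → B → Set} {I} (f : A → B) →
                (∀ {x} → P x → Q (f x)) → (∀ {x y} → P x → P y → f x ≈ f y → x ~ y) →
                (∀ {y} → Q y → ∃ λ x → P x × ∀ {x′} → x ~ x′ → y ≈ f x′) →
                Classes P _~_ I → Classes Q _≈_ I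
  Classes-map {Q = Q} {_≈_ = _≈_} f P⇒Q∘f f-inj f-surj (r , P-r , r-inj , r-surj) =
    f ∘ r , P⇒Q∘f ∘ P-r , (λ i j e → r-inj i j (f-inj (P-r i) (P-r j) e)) , surj
    where
    surj : ∀ y → Q y → ∃ λ i → y ≈ f (r i)
    surj y Qy with f-surj Qy
    ... | x , Px , y≈f with r-surj x Px
    ...   | i , x~ri = i , y≈f x~ri

Classes-cons : ∀ {A : Set} {n} {P : A → Set} {Q : Vector A n → Set} {I J} →
               Classes P _≡_ I → Classes Q _≗_ J →
               Classes (λ v → P (head v) × Q (tail v)) _≗_ (I × J)
Classes-cons {P = P} {Q} (r , P-r , r-inj , r-surj) (s , Q-s , s-inj , s-surj) =
  (λ (i , j) → r i ∷ s j) , (λ (i , j) → P-r i , Q-s j) ,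
  (λ (i , j) (i′ , j′) e → cong₂ _,_ (r-inj i i′ (e zero)) (s-inj j j′ (e ∘ suc))) , surj
  where
  surj : ∀ v → P (head v) × Q (tail v) → ∃ λ ij → v ≗ r (proj₁ ij) ∷ s (proj₂ ij)
  surj v (Pv₀ , Qv′) with r-surj (head v) Pv₀ | s-surj (tail v) Qv′
  ... | i , v₀≡ri | j , v′≗sj = (i , j) , λ { zero → v₀≡ri ; (suc l) → v′≗sj l }

Interval : ℕ → ℕ → ℤ → Set
Interval lo n z = + lo ≤ z × z < + (lo ℕ.+ n)

interval-classes : ∀ lo n → Classes (Interval lo n) _≡_ (Fin n)
interval-classes lo n = r , Interval-r , r-inj , r-surj
  where
  r : Fin n → ℤ
  r i = + (lo ℕ.+ toℕ i)
  Interval-r : ∀ i → Interval lo n (r i)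
  Interval-r i = +≤+ (ℕP.m≤m+n lo (toℕ i)) , +<+ (ℕP.+-monoʳ-< lo (toℕ<n i))
  r-inj : ∀ i j → r i ≡ r j → i ≡ j
  r-inj i j e = toℕ-injective (ℕP.+-cancelˡ-≡ lo (toℕ i) (toℕ j) (ℤP.+-injective e))
  r-surj : ∀ z → Interval lo n z → ∃ λ i → z ≡ r i
  r-surj (+ m) (+≤+ lo≤m , +<+ m<lo+n) = fromℕ< m∸lo<n , cong +_ (begin
    m                                  ≡⟨ ℕP.m+[n∸m]≡n lo≤m ⟨
    lo ℕ.+ (m ℕ.∸ lo)                  ≡⟨ cong (lo ℕ.+_) (toℕ-fromℕ< m∸lo<n) ⟨
    lo ℕ.+ toℕ (fromℕ< m∸lo<n)         ∎)
    where
    open ≡-Reasoning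
    m∸lo<n : m ℕ.∸ lo ℕ.< n
    m∸lo<n = subst (m ℕ.∸ lo ℕ.<_) (ℕP.m+n∸m≡n lo n) (ℕP.∸-monoˡ-< m<lo+n lo≤m)

Interval-0-1 : ∀ {z} → Interval 0 1 z → z ≡ + 0
Interval-0-1 {+ zero} _ = refl
Interval-0-1 {+ suc m} (_ , +<+ (s≤s ()))

Box : ∀ {n} → Vector ℕ n → Vector ℤ n → Set
Box k e = ∀ j → Interval 0 (suc (k j)) (e j)

HasZero : ∀ {n} → Vector ℤ n → Set
HasZero e = ∃ λ j → e j ≡ + 0

NormalForm : ∀ {n} → Vector ℕ n → Vector ℤ n → Set
NormalForm k e = Box k e × HasZero e

boxSize : ∀ {n} → Vector ℕ n → ℕ
boxSize {zero}  k = 1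
boxSize {suc n} k = suc (head k) ℕ.* boxSize (tail k)

-- a normal form starts with 0 followed by any point of the box, or with 1, …, k₀ followed by a normal form
normalFormCount : ∀ {n} → Vector ℕ n → ℕ
normalFormCount {zero}  k = 0
normalFormCount {suc n} k = 1 ℕ.* boxSize (tail k) ℕ.+ head k ℕ.* normalFormCount (tail k)

box-classes : ∀ {n} (k : Vector ℕ n) → Classes (Box k) _≗_ (Fin (boxSize k))
box-classes {zero}  k = (λ _ ()) , (λ _ ()) , (λ { zero zero _ → refl }) , (λ _ _ → zero , λ ())
box-classes {suc n} k =
  Classes-↔ _≗_ *↔× (Classes-≐ _≗_ Box-∷
    (Classes-cons (interval-classes 0 (suc (head k))) (box-classes (tail k))))
  where
  Box-∷ : (λ e → Interval 0 (suc (head k)) (head e) × Box (tail k) (tail e)) ≐ Box k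
  Box-∷ = (λ (b₀ , b′) → λ { zero → b₀ ; (suc j) → b′ j }) , λ b → b zero , b ∘ suc

normalForm-classes : ∀ {n} (k : Vector ℕ n) → Classes (NormalForm k) _≗_ (Fin (normalFormCount k))
normalForm-classes {zero}  k = (λ ()) , (λ ()) , (λ ()) , λ { _ (_ , () , _) }
normalForm-classes {suc n} k =
  Classes-↔ _≗_ +↔⊎ (Classes-≐ _≗_ NormalForm-∷ (Classes-⊎ _≗_ (λ e j → sym (e j)) disjoint
    (Classes-↔ _≗_ *↔× (Classes-cons (interval-classes 0 1) (box-classes (tail k))))
    (Classes-↔ _≗_ *↔× (Classes-cons (interval-classes 1 (head k)) (normalForm-classes (tail k))))))
  where
  StartsWith0 StartsPositive : Vector ℤ (suc n) → Set
  StartsWith0    e = Interval 0 1 (head e) × Box (tail k) (tail e)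
  StartsPositive e = Interval 1 (head k) (head e) × NormalForm (tail k) (tail e)
  disjoint : ∀ {e e′} → StartsWith0 e → StartsPositive e′ → ¬ e ≗ e′
  disjoint ((_ , e₀<1) , _) ((1≤e′₀ , _) , _) e≗e′ =
    ℤP.<⇒≱ e₀<1 (subst (+ 1 ≤_) (sym (e≗e′ zero)) 1≤e′₀)
  NormalForm-∷ : (StartsWith0 ∪ StartsPositive) ≐ NormalForm k
  proj₁ NormalForm-∷ (inj₁ ((0≤e₀ , e₀<1) , b′)) =
    (λ { zero → 0≤e₀ , ℤP.<-≤-trans e₀<1 (+≤+ (s≤s z≤n)) ; (suc j) → b′ j }) ,
    zero , Interval-0-1 (0≤e₀ , e₀<1)
  proj₁ NormalForm-∷ (inj₂ ((1≤e₀ , e₀≤k₀) , b′ , j , e′ⱼ≡0)) =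
    (λ { zero → ℤP.≤-trans (+≤+ z≤n) 1≤e₀ , e₀≤k₀ ; (suc j) → b′ j }) , suc j , e′ⱼ≡0
  proj₂ NormalForm-∷ {e} (b , j , eⱼ≡0) with e zero ℤP.<? + 1
  ... | yes e₀<1 = inj₁ ((proj₁ (b zero) , e₀<1) , b ∘ suc)
  ... | no e₀≮1 = inj₂ ((ℤP.≮⇒≥ e₀≮1 , proj₂ (b zero)) , b ∘ suc , tailZero j eⱼ≡0)
    where
    tailZero : ∀ j → e j ≡ + 0 → HasZero (tail e)
    tailZero zero    e₀≡0  = ⊥-elim (e₀≮1 (subst (_< + 1) (sym e₀≡0) (+<+ (s≤s z≤n))))
    tailZero (suc j) eⱼ≡0′ = j , eⱼ≡0′

boxSize-formula : ∀ {n} (k : Vector ℕ n) → + boxSize k ≡ prodℤ (λ i → + suc (k i))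
boxSize-formula {zero}  k = refl
boxSize-formula {suc n} k =
  trans (ℤP.pos-* (suc (head k)) (boxSize (tail k))) (cong (+ suc (head k) *_) (boxSize-formula (tail k)))

normalFormCount-formula : ∀ {n} (k : Vector ℕ n) →
                          + normalFormCount k ≡ prodℤ (λ i → + suc (k i)) - prodℤ (λ i → + k i)
normalFormCount-formula {zero}  k = refl
normalFormCount-formula {suc n} k = begin
  + (1 ℕ.* B ℕ.+ head k ℕ.* N)           ≡⟨ ℤP.pos-+ (1 ℕ.* B) (head k ℕ.* N) ⟩
  + (1 ℕ.* B) + + (head k ℕ.* N)         ≡⟨ cong₂ _+_ (ℤP.pos-* 1 B) (ℤP.pos-* (head k) N) ⟩
  + 1 * + B + + head k * + N             ≡⟨ cong₂ (λ b n → + 1 * b + + head k * n)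
                                                    (boxSize-formula (tail k)) (normalFormCount-formula (tail k)) ⟩
  + 1 * P + + head k * (P - K)           ≡⟨ expand P K (+ head k) ⟩
  (+ 1 + + head k) * P - + head k * K    ∎
  where
  open ≡-Reasoning
  B = boxSize (tail k)
  N = normalFormCount (tail k)
  P = prodℤ (λ i → + suc (k (suc i)))
  K = prodℤ (λ i → + k (suc i))
  expand : ∀ P K a → + 1 * P + a * (P - K) ≡ (+ 1 + a) * P - a * K
  expand = solve-∀

vecMatM : ∀ {d} → Vector ℕ (suc d) → Vector ℤ (suc d) → Vector ℤ (suc d)
vecMatM k b j = b j * + suc (k j) + b (cyc⁻¹ j) * - + k j

vecMat-M : ∀ {d} k (b : Vector ℤ (suc (suc d))) → vecMat (suc d) b (M (suc d) k) ≗ vecMatM k b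
vecMat-M {d} k b j =
  trans (sumℤ-pair {f = λ l → b l * M (suc d) k l j} j (cyc⁻¹ j) (cyc⁻¹-irrefl j ∘ sym) offRows≡0)
        (cong₂ _+_ (cong (b j *_) (M-diag k j)) (cong (b (cyc⁻¹ j) *_) (M-cyc⁻¹ k j)))
  where
  offRows≡0 : ∀ l → l ≢ j → l ≢ cyc⁻¹ j → b l * M (suc d) k l j ≡ + 0
  offRows≡0 l l≢j l≢cyc⁻¹j = trans (cong (b l *_) (M-zero k l j (l≢j ∘ sym) l≢cyc⁻¹j)) (ℤP.*-zeroʳ (b l))

vecMatM-+const : ∀ {d} k (b : Vector ℤ (suc d)) t j → vecMatM k (λ i → b i + t) j ≡ vecMatM k b j + t
vecMatM-+const k b t j = expand (b j) (b (cyc⁻¹ j)) t (+ k j)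
  where
  expand : ∀ b b′ t k → (b + t) * (+ 1 + k) + (b′ + t) * - k ≡ b * (+ 1 + k) + b′ * - k + t
  expand = solve-∀

vecMatM-neg : ∀ {d} k (b : Vector ℤ (suc d)) j → vecMatM k (λ i → - b i) j ≡ - vecMatM k b j
vecMatM-neg k b j = expand (b j) (b (cyc⁻¹ j)) (+ k j)
  where
  expand : ∀ b b′ k → - b * (+ 1 + k) + - b′ * - k ≡ - (b * (+ 1 + k) + b′ * - k)
  expand = solve-∀

δℤ-refl : ∀ {n} (i : Fin n) → δℤ i i ≡ + 1
δℤ-refl i with i ≟ i
... | yes _  = refl
... | no i≢i = ⊥-elim (i≢i refl)

δℤ-≢ : ∀ {n} {i j : Fin n} → i ≢ j → δℤ i j ≡ + 0
δℤ-≢ {i = i} {j} i≢j with i ≟ j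
... | yes e = ⊥-elim (i≢j e)
... | no _  = refl

combW-formula : ∀ d a j → combW d a j ≡ + suc d * a j - sumℤ a
combW-formula d a j = begin
  sumℤ (λ i → a i * w d i j)
    ≡⟨ sumℤ-cong (λ i → expand (a i) (+ suc d) (δℤ i j)) ⟩
  sumℤ (λ i → + suc d * (a i * δℤ i j) + - a i)
    ≡⟨ sumℤ-+ (λ i → + suc d * (a i * δℤ i j)) (λ i → - a i) ⟩
  sumℤ (λ i → + suc d * (a i * δℤ i j)) + sumℤ (λ i → - a i)
    ≡⟨ cong₂ _+_ (sumℤ-*ˡ (+ suc d) (λ i → a i * δℤ i j)) (sumℤ-neg a) ⟩
  + suc d * sumℤ (λ i → a i * δℤ i j) - sumℤ a
    ≡⟨ cong (λ s → + suc d * s - sumℤ a) (sumℤ-single j aδ≡0) ⟩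
  + suc d * (a j * δℤ j j) - sumℤ a
    ≡⟨ cong (λ x → + suc d * x - sumℤ a) (trans (cong (a j *_) (δℤ-refl j)) (ℤP.*-identityʳ (a j))) ⟩
  + suc d * a j - sumℤ a
    ∎
  where
  open ≡-Reasoning
  expand : ∀ x N δ → x * (N * δ - + 1) ≡ N * (x * δ) + - x
  expand = solve-∀
  aδ≡0 : ∀ i → i ≢ j → a i * δℤ i j ≡ + 0
  aδ≡0 i i≢j = trans (cong (a i *_) (δℤ-≢ i≢j)) (ℤP.*-zeroʳ (a i))

combW-cong : ∀ d {x y} → x ≗ y → combW d x ≗ combW d y
combW-cong d x≗y j = sumℤ-cong (λ i → cong (_* w d i j) (x≗y i))

combW-sub : ∀ d x y j → combW d (λ i → x i - y i) j ≡ combW d x j - combW d y j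
combW-sub d x y j = begin
  combW d (λ i → x i - y i) j                           ≡⟨ combW-formula d (λ i → x i - y i) j ⟩
  + suc d * (x j - y j) - sumℤ (λ i → x i + - y i)
    ≡⟨ cong (λ s → + suc d * (x j - y j) - s) (trans (sumℤ-+ x (λ i → - y i)) (cong (_+_ (sumℤ x)) (sumℤ-neg y))) ⟩
  + suc d * (x j - y j) - (sumℤ x - sumℤ y)             ≡⟨ regroup (+ suc d) (x j) (y j) (sumℤ x) (sumℤ y) ⟩
  (+ suc d * x j - sumℤ x) - (+ suc d * y j - sumℤ y)   ≡⟨ cong₂ _-_ (combW-formula d x j) (combW-formula d y j) ⟨
  combW d x j - combW d y j                             ∎
  where
  open ≡-Reasoning
  regroup : ∀ N a b A B → N * (a - b) - (A - B) ≡ (N * a - A) - (N * b - B)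
  regroup = solve-∀

combW-neg : ∀ d x j → combW d (λ i → - x i) j ≡ - combW d x j
combW-neg d x j =
  trans (sumℤ-cong (λ i → sym (ℤP.neg-distribˡ-* (x i) (w d i j)))) (sumℤ-neg (λ i → x i * w d i j))

combW-kernel : ∀ d {x y} → combW d x ≗ combW d y → ∃ λ c → ∀ j → x j ≡ y j + c
combW-kernel d {x} {y} images≡ = x zero - y zero , λ j →
  trans (split (x j) (y j)) (cong (_+_ (y j)) (ℤP.*-cancelˡ-≡ (+ suc d) _ _ (trans (scaled j) (sym (scaled zero)))))
  where
  split : ∀ a b → a ≡ b + (a - b)
  split = solve-∀
  scaled : ∀ j → + suc d * (x j - y j) ≡ sumℤ (λ i → x i - y i)
  scaled j = ℤP.i-j≡0⇒i≡j _ _ (begin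
    + suc d * (x j - y j) - sumℤ (λ i → x i - y i)  ≡⟨ combW-formula d (λ i → x i - y i) j ⟨
    combW d (λ i → x i - y i) j                     ≡⟨ combW-sub d x y j ⟩
    combW d x j - combW d y j                       ≡⟨ ℤP.i≡j⇒i-j≡0 (images≡ j) ⟩
    + 0                                             ∎)
    where open ≡-Reasoning

vecMat-neg : ∀ d (b : Vector ℤ (suc d)) A j → vecMat d (λ l → - b l) A j ≡ - vecMat d b A j
vecMat-neg d b A j = trans (sumℤ-cong (λ l → sym (ℤP.neg-distribˡ-* (b l) (A l j)))) (sumℤ-neg (λ l → b l * A l j))

InL-resp-≗ : ∀ d k {x y} → x ≗ y → InL d k x → InL d k y
InL-resp-≗ d k x≗y (b , x≡) = b , λ j → trans (sym (x≗y j)) (x≡ j)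

InL-neg : ∀ d k {x} → InL d k x → InL d k (λ j → - x j)
InL-neg d k {x} (b , x≡) = (λ l → - b l) , λ j → begin
  - x j                                         ≡⟨ cong -_ (x≡ j) ⟩
  - combW d (vecMat d b (M d k)) j              ≡⟨ combW-neg d (vecMat d b (M d k)) j ⟨
  combW d (λ i → - vecMat d b (M d k) i) j      ≡⟨ combW-cong d (vecMat-neg d b (M d k)) j ⟨
  combW d (vecMat d (λ l → - b l) (M d k)) j    ∎
  where open ≡-Reasoning

InL-vecMatM : ∀ {d} k b → InL (suc d) k (combW (suc d) (vecMatM k b))
InL-vecMatM {d} k b = b , combW-cong (suc d) (sym ∘ vecMat-M k b)

extremum : ∀ {A : Set} {_≼_ : A → A → Set} → Reflexive _≼_ → Transitive _≼_ → Total _≼_ →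
           ∀ {n} (s : Vector A (suc n)) → ∃ λ j → ∀ i → s i ≼ s j
extremum ≼-refl ≼-trans ≼-total {zero}  s = zero , λ { zero → ≼-refl }
extremum ≼-refl ≼-trans ≼-total {suc n} s with extremum ≼-refl ≼-trans ≼-total (s ∘ suc)
... | j , s′≼sⱼ with ≼-total (s zero) (s (suc j))
...   | inj₁ s₀≼sⱼ = suc j , λ { zero → s₀≼sⱼ ; (suc i) → s′≼sⱼ i }
...   | inj₂ sⱼ≼s₀ = zero  , λ { zero → ≼-refl ; (suc i) → ≼-trans (s′≼sⱼ i) sⱼ≼s₀ }

argmax : ∀ {n} (s : Vector ℤ (suc n)) → ∃ λ j → ∀ i → s i ≤ s j
argmax = extremum ℤP.≤-refl ℤP.≤-trans ℤP.≤-total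

argmin : ∀ {n} (s : Vector ℤ (suc n)) → ∃ λ j → ∀ i → s j ≤ s i
argmin = extremum ℤP.≤-refl (λ i≥j j≥k → ℤP.≤-trans j≥k i≥j) (λ i j → ℤP.≤-total j i)

all-from-cyc⁻¹-closed : ∀ {d} (P : Fin (suc d) → Set) → (∀ j → P j → P (cyc⁻¹ j)) →
                        ∀ {j} → P j → ∀ i → P i
all-from-cyc⁻¹-closed P step {j} Pj = >-weakInduction P (step zero P₀) (step ∘ suc)
  where
  P₀ : P zero
  P₀ = <-weakInduction (λ i → P i → P zero) id (λ i P[i]⇒P₀ → P[i]⇒P₀ ∘ step (suc i)) j Pj

*-nonNeg : ∀ {i j} → + 0 ≤ i → + 0 ≤ j → + 0 ≤ i * j
*-nonNeg (+≤+ {n = m} _) (+≤+ {n = n} _) = subst (+ 0 ≤_) (ℤP.pos-* m n) (+≤+ z≤n)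

-- the j-th coordinate of s M_k when s_j is a strict maximum over s_{j-1}
rowValue-bound : ∀ {m t} k → + 1 ≤ m → t < m → + suc k ≤ m * + suc k + t * - + k
rowValue-bound {m} {t} k 1≤m t<m = ℤP.0≤i-j⇒j≤i (subst (+ 0 ≤_) (sym (regroup m t (+ k)))
  (ℤP.+-mono-≤ (ℤP.i≤j⇒0≤j-i 1≤m) (*-nonNeg {i = + k} (+≤+ z≤n) (ℤP.i≤j⇒0≤j-i (ℤP.i<j⇒suc[i]≤j t<m)))))
  where
  regroup : ∀ m t k → m * (+ 1 + k) + t * - k - (+ 1 + k) ≡ (m - + 1) + k * (m - (+ 1 + t))
  regroup = solve-∀

-- A positive maximum of s spreads backwards around the cycle, since otherwise some e_j − e′_j would exceed k_j.
vecMatM-nonPositive : ∀ {d} (k : Vector ℕ (suc d)) {e e′ s} → Box k e → Box k e′ → HasZero e →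
                      (∀ j → e j - e′ j ≡ vecMatM k s j) → ∀ j → s j ≤ + 0
vecMatM-nonPositive k {e} {e′} {s} box box′ (x , eₓ≡0) diff≡ j with argmax s
... | m , s≤sₘ with s m ℤP.≤? + 0
...   | yes sₘ≤0 = ℤP.≤-trans (s≤sₘ j) sₘ≤0
...   | no sₘ≰0  = ⊥-elim (ℤP.<⇒≱ 0<sₘ (subst (_≤ + 0) (trans (diff≡ x) (vecMatM-constant x)) eₓ-e′ₓ≤0))
  where
  0<sₘ : + 0 < s m
  0<sₘ = ℤP.≰⇒> sₘ≰0
  difference<k+1 : ∀ j → e j - e′ j < + suc (k j)
  difference<k+1 j = ℤP.≤-<-trans (ℤP.i-j≤i (e j) (e′ j) {{nonNegative (proj₁ (box′ j))}}) (proj₂ (box j))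
  stays : ∀ j → s j ≡ s m → s (cyc⁻¹ j) ≡ s m
  stays j sⱼ≡sₘ with s (cyc⁻¹ j) ℤP.≟ s m
  ... | yes sⱼ₋₁≡sₘ = sⱼ₋₁≡sₘ
  ... | no ne = ⊥-elim (ℤP.<⇒≱ (difference<k+1 j) (subst (+ suc (k j) ≤_) (sym (trans (diff≡ j) sⱼ-term))
                  (rowValue-bound (k j) (ℤP.i<j⇒suc[i]≤j 0<sₘ) (ℤP.≤∧≢⇒< (s≤sₘ (cyc⁻¹ j)) ne))))
    where
    sⱼ-term : vecMatM k s j ≡ s m * + suc (k j) + s (cyc⁻¹ j) * - + k j
    sⱼ-term = cong (λ x → x * + suc (k j) + s (cyc⁻¹ j) * - + k j) sⱼ≡sₘ
  constant : ∀ i → s i ≡ s m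
  constant = all-from-cyc⁻¹-closed (λ i → s i ≡ s m) stays refl
  vecMatM-constant : ∀ j → vecMatM k s j ≡ s m
  vecMatM-constant j = trans (cong₂ (λ x y → x * + suc (k j) + y * - + k j) (constant j) (constant (cyc⁻¹ j)))
                             (collapse (s m) (+ k j))
    where
    collapse : ∀ x k → x * (+ 1 + k) + x * - k ≡ x
    collapse = solve-∀
  eₓ-e′ₓ≤0 : e x - e′ x ≤ + 0
  eₓ-e′ₓ≤0 = subst (_≤ + 0) (trans (sym (ℤP.+-identityˡ (- e′ x))) (cong (_- e′ x) (sym eₓ≡0)))
                   (ℤP.neg-mono-≤ (proj₁ (box′ x)))

normalForm-unique : ∀ {d} (k : Vector ℕ (suc d)) {e e′ s} → NormalForm k e → NormalForm k e′ →
                    (∀ j → e j - e′ j ≡ vecMatM k s j) → e ≗ e′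
normalForm-unique k {e} {e′} {s} (box , hasZero) (box′ , hasZero′) diff≡ j = begin
  e j                     ≡⟨ split (e j) (e′ j) ⟩
  e j - e′ j + e′ j       ≡⟨ cong (_+ e′ j) (diff≡ j) ⟩
  vecMatM k s j + e′ j    ≡⟨ cong₂ (λ x y → x * + suc (k j) + y * - + k j + e′ j) (s≡0 j) (s≡0 (cyc⁻¹ j)) ⟩
  + 0 + e′ j              ≡⟨ ℤP.+-identityˡ (e′ j) ⟩
  e′ j                    ∎
  where
  open ≡-Reasoning
  split : ∀ a b → a ≡ a - b + b
  split = solve-∀
  flip-diff : ∀ j → e′ j - e j ≡ vecMatM k (λ i → - s i) j
  flip-diff j = trans (swap (e j) (e′ j)) (trans (cong -_ (diff≡ j)) (sym (vecMatM-neg k s j)))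
    where
    swap : ∀ a b → b - a ≡ - (a - b)
    swap = solve-∀
  s≡0 : ∀ i → s i ≡ + 0
  s≡0 i = ℤP.≤-antisym (vecMatM-nonPositive k {s = s} box box′ hasZero diff≡ i)
            (subst (+ 0 ≤_) (ℤP.neg-involutive (s i))
                   (ℤP.neg-mono-≤ (vecMatM-nonPositive k {s = λ i → - s i} box′ box hasZero′ flip-diff i)))

congL-normalForm-unique : ∀ {d} (k : Vector ℕ (suc (suc d))) {e e′} → NormalForm k e → NormalForm k e′ →
                          CongL (suc d) k (combW (suc d) e) (combW (suc d) e′) → e ≗ e′
congL-normalForm-unique {d} k {e} {e′} nf nf′ (b , diff≡) =
  normalForm-unique k {s = λ i → b i + c} nf nf′ λ j →
    trans (diff≡bM+c j) (trans (cong (_+ c) (vecMat-M k b j)) (sym (vecMatM-+const k b c j)))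
  where
  kernel : ∃ λ c → ∀ j → e j - e′ j ≡ vecMat (suc d) b (M (suc d) k) j + c
  kernel = combW-kernel (suc d) {x = λ i → e i - e′ i} {y = vecMat (suc d) b (M (suc d) k)}
                        (λ j → trans (combW-sub (suc d) e e′ j) (diff≡ j))
  c = proj₁ kernel
  diff≡bM+c = proj₂ kernel

fixedPoint : ∀ (g : ℤ → ℤ) → g Preserves _≤_ ⟶ _≤_ → ∀ {l u} → l ≤ g l → g u ≤ u → l ≤ u →
             ∃ λ t → g t ≡ t
fixedPoint g g-mono {l} {u} l≤gl gu≤u l≤u = climb ∣ u - l ∣ l l≤gl l≤u u≤l+gap
  where
  undo : ∀ l u → u ≡ l + (u - l)
  undo = solve-∀
  u≤l+gap : u ≤ l + + ∣ u - l ∣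
  u≤l+gap = ℤP.≤-reflexive (trans (undo l u) (cong (_+_ l) (sym (ℤP.0≤i⇒+∣i∣≡i (ℤP.i≤j⇒0≤j-i l≤u)))))
  -- every step that is not yet a fixed point goes up by at least one, without passing u
  climb : ∀ n t → t ≤ g t → t ≤ u → u ≤ t + + n → ∃ λ t → g t ≡ t
  climb zero t t≤gt t≤u u≤t+0 =
    t , ℤP.≤-antisym (ℤP.≤-trans (g-mono t≤u) (ℤP.≤-trans gu≤u (subst (u ≤_) (ℤP.+-identityʳ t) u≤t+0))) t≤gt
  climb (suc n) t t≤gt t≤u u≤t+n+1 with g t ℤP.≟ t
  ... | yes gt≡t = t , gt≡t
  ... | no gt≢t  = climb n (g t) (g-mono t≤gt) (ℤP.≤-trans (g-mono t≤u) gu≤u)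
    (ℤP.≤-trans u≤t+n+1 (subst (_≤ g t + + n) (shift t (+ n))
      (ℤP.+-monoˡ-≤ (+ n) (ℤP.i<j⇒suc[i]≤j (ℤP.≤∧≢⇒< t≤gt (gt≢t ∘ sym))))))
    where
    shift : ∀ t n → + 1 + t + n ≡ t + (+ 1 + n)
    shift = solve-∀

chain : ∀ {d} → (Fin (suc d) → ℤ → ℤ) → ℤ → Fin (suc d) → ℤ
chain     F t zero    = t
chain {suc d} F t (suc i) = chain (F ∘ suc) (F (suc zero) t) i

chain-suc : ∀ {d} (F : Fin (suc d) → ℤ → ℤ) t i → chain F t (suc i) ≡ F (suc i) (chain F t (inject₁ i))
chain-suc F t zero            = refl
chain-suc {suc d} F t (suc i) = chain-suc (F ∘ suc) (F (suc zero) t) i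

chain-mono : ∀ {d} {F : Fin (suc d) → ℤ → ℤ} → (∀ j → F j Preserves _≤_ ⟶ _≤_) →
             ∀ i → (λ t → chain F t i) Preserves _≤_ ⟶ _≤_
chain-mono F-mono zero            t≤t′ = t≤t′
chain-mono {suc d} F-mono (suc i) t≤t′ = chain-mono (F-mono ∘ suc) i (F-mono (suc zero) t≤t′)

chain-preserves : ∀ {d} {F : Fin (suc d) → ℤ → ℤ} (Q : ℤ → Set) → (∀ j {t} → Q t → Q (F j t)) →
                  ∀ {t} i → Q t → Q (chain F t i)
chain-preserves Q F-closed zero            Qt = Qt
chain-preserves {suc d} Q F-closed (suc i) Qt = chain-preserves Q (F-closed ∘ suc) i (F-closed (suc zero) Qt)

-- Start the chain at a fixed point of F_0 ∘ F_d ∘ ⋯ ∘ F_1.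
cyclicSystem-solvable : ∀ {d} (F : Fin (suc d) → ℤ → ℤ) → (∀ j → F j Preserves _≤_ ⟶ _≤_) →
                        ∀ {l u} → (∀ j → l ≤ F j l) → (∀ j → F j u ≤ u) → l ≤ u →
                        ∃ λ b → ∀ j → b j ≡ F j (b (cyc⁻¹ j))
cyclicSystem-solvable {d} F F-mono {l} {u} l≤Fl Fu≤u l≤u =
  chain F t , λ { zero → sym Gt≡t ; (suc i) → chain-suc F t i }
  where
  G : ℤ → ℤ
  G t = F zero (chain F t (fromℕ d))
  G-mono : G Preserves _≤_ ⟶ _≤_
  G-mono = F-mono zero ∘ chain-mono F-mono (fromℕ d)
  l≤Gl : l ≤ G l
  l≤Gl = ℤP.≤-trans (l≤Fl zero) (F-mono zero
    (chain-preserves (l ≤_) (λ j l≤t → ℤP.≤-trans (l≤Fl j) (F-mono j l≤t)) (fromℕ d) ℤP.≤-refl))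
  Gu≤u : G u ≤ u
  Gu≤u = ℤP.≤-trans (F-mono zero
    (chain-preserves (_≤ u) (λ j t≤u → ℤP.≤-trans (F-mono j t≤u) (Fu≤u j)) (fromℕ d) ℤP.≤-refl)) (Fu≤u zero)
  fixed : ∃ λ t → G t ≡ t
  fixed = fixedPoint G G-mono l≤Gl Gu≤u l≤u
  t = proj₁ fixed
  Gt≡t = proj₂ fixed

≤-/ℕ : ∀ {c x} n → c * + suc n ≤ x → c ≤ x /ℕ suc n
≤-/ℕ {c} {x} n cd≤x with c ℤP.≤? x /ℕ suc n
... | yes c≤q = c≤q
... | no c≰q  = ⊥-elim (ℤP.<-irrefl refl (ℤP.<-≤-trans (n<s[n/ℕd]*d x (suc n))
                  (ℤP.≤-trans (ℤP.*-monoʳ-≤-nonNeg (+ suc n) (ℤP.i<j⇒suc[i]≤j (ℤP.≰⇒> c≰q))) cd≤x)))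

/ℕ-≤ : ∀ {c x} n → x ≤ c * + suc n → x /ℕ suc n ≤ c
/ℕ-≤ {c} {x} n x≤cd = ℤP.*-cancelʳ-≤-pos (x /ℕ suc n) c (+ suc n) (ℤP.≤-trans ([n/ℕd]*d≤n x (suc n)) x≤cd)

/ℕ-mono : ∀ n → (_/ℕ suc n) Preserves _≤_ ⟶ _≤_
/ℕ-mono n {x} x≤y = ≤-/ℕ n (ℤP.≤-trans ([n/ℕd]*d≤n x (suc n)) x≤y)

-- Solving b_j = ⌊(a_j + k_j b_{j-1}) / (k_j + 1)⌋ leaves remainders in [0, k_j] with a = e + b M_k.
box-representative : ∀ {d} (k : Vector ℕ (suc d)) a →
                     ∃ λ e → Box k e × ∃ λ b → ∀ j → a j ≡ e j + vecMatM k b j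
box-representative {d} k a = e , (λ j → +≤+ z≤n , +<+ (n%ℕd<d (x j) (suc (k j)))) , b , a≡e+bM
  where
  lowest = argmin a
  highest = argmax a
  l = a (proj₁ lowest)
  u = a (proj₁ highest)
  F : Fin (suc d) → ℤ → ℤ
  F j t = (a j + + k j * t) /ℕ suc (k j)
  F-mono : ∀ j → F j Preserves _≤_ ⟶ _≤_
  F-mono j = /ℕ-mono (k j) ∘ ℤP.+-monoʳ-≤ (a j) ∘ ℤP.*-monoˡ-≤-nonNeg (+ k j)
  regroup : ∀ t k → t + k * t ≡ t * (+ 1 + k)
  regroup = solve-∀
  l≤Fl : ∀ j → l ≤ F j l
  l≤Fl j = ≤-/ℕ (k j)
    (subst (_≤ a j + + k j * l) (regroup l (+ k j)) (ℤP.+-monoˡ-≤ (+ k j * l) (proj₂ lowest j)))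
  Fu≤u : ∀ j → F j u ≤ u
  Fu≤u j = /ℕ-≤ (k j)
    (subst (a j + + k j * u ≤_) (regroup u (+ k j)) (ℤP.+-monoˡ-≤ (+ k j * u) (proj₂ highest j)))
  solution : ∃ λ b → ∀ j → b j ≡ F j (b (cyc⁻¹ j))
  solution = cyclicSystem-solvable F F-mono l≤Fl Fu≤u (ℤP.≤-trans (proj₂ lowest zero) (proj₂ highest zero))
  b = proj₁ solution
  x : Fin (suc d) → ℤ
  x j = a j + + k j * b (cyc⁻¹ j)
  e : Fin (suc d) → ℤ
  e j = + (x j %ℕ suc (k j))
  a≡e+bM : ∀ j → a j ≡ e j + vecMatM k b j
  a≡e+bM j = begin
    a j                                  ≡⟨ isolate (a j) (+ k j) b′ ⟩
    x j - + k j * b′                     ≡⟨ cong (_- + k j * b′) (a≡a%ℕn+[a/ℕn]*n (x j) (suc (k j))) ⟩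
    e j + F j b′ * + suc (k j) - + k j * b′ ≡⟨ cong (λ q → e j + q * + suc (k j) - + k j * b′) (proj₂ solution j) ⟨
    e j + b j * + suc (k j) - + k j * b′ ≡⟨ regroup′ (e j) (b j) b′ (+ k j) ⟩
    e j + vecMatM k b j                  ∎
    where
    open ≡-Reasoning
    b′ = b (cyc⁻¹ j)
    isolate : ∀ a k b → a ≡ a + k * b - k * b
    isolate = solve-∀
    regroup′ : ∀ e b b′ k → e + b * (+ 1 + k) - k * b′ ≡ e + (b * (+ 1 + k) + b′ * - k)
    regroup′ = solve-∀

normalForm-exists : ∀ {d} (k : Vector ℕ (suc d)) a →
                    ∃ λ e → NormalForm k e × ∃ λ b → ∀ j → a j ≡ e j + vecMatM k b j
normalForm-exists {d} k a = (λ j → e j - e m) , (box′ , m , ℤP.+-inverseʳ (e m)) , (λ i → b i + e m) , λ j →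
  trans (a≡e+bM j) (trans (shift (e j) (e m) (vecMatM k b j))
                          (cong (_+_ (e j - e m)) (sym (vecMatM-+const k b (e m) j))))
  where
  representative = box-representative k a
  e = proj₁ representative
  box = proj₁ (proj₂ representative)
  b = proj₁ (proj₂ (proj₂ representative))
  a≡e+bM = proj₂ (proj₂ (proj₂ representative))
  lowest = argmin e
  m = proj₁ lowest
  shift : ∀ x c v → x + v ≡ x - c + (v + c)
  shift = solve-∀
  box′ : Box k (λ j → e j - e m)
  box′ j = ℤP.i≤j⇒0≤j-i (proj₂ lowest j) ,
           ℤP.≤-<-trans (ℤP.i-j≤i (e j) (e m) {{nonNegative (proj₁ (box m))}}) (proj₂ (box j))

InΛ-normalForm : ∀ {d} (k : Vector ℕ (suc (suc d))) {x} → InΛ (suc d) x →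
                 ∃ λ e → NormalForm k e × ∀ {e′} → e ≗ e′ → CongL (suc d) k x (combW (suc d) e′)
InΛ-normalForm {d} k {x} (a , x≡) = e , nf , λ {e′} e≗e′ →
  InL-resp-≗ (suc d) k {x = combW (suc d) (vecMatM k b)} {y = λ j → x j - combW (suc d) e′ j}
    (λ j → sym (begin
      x j - combW (suc d) e′ j                  ≡⟨ cong (_- combW (suc d) e′ j) (x≡ j) ⟩
      combW (suc d) a j - combW (suc d) e′ j    ≡⟨ combW-sub (suc d) a e′ j ⟨
      combW (suc d) (λ i → a i - e′ i) j        ≡⟨ combW-cong (suc d) (a-e′≡bM e≗e′) j ⟩
      combW (suc d) (vecMatM k b) j             ∎))
    (InL-vecMatM k b)
  where
  open ≡-Reasoning
  normalForm = normalForm-exists k a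
  e = proj₁ normalForm
  nf = proj₁ (proj₂ normalForm)
  b = proj₁ (proj₂ (proj₂ normalForm))
  a≡e+bM = proj₂ (proj₂ (proj₂ normalForm))
  cancel : ∀ e v → e + v - e ≡ v
  cancel = solve-∀
  a-e′≡bM : ∀ {e′} → e ≗ e′ → ∀ i → a i - e′ i ≡ vecMatM k b i
  a-e′≡bM e≗e′ i = trans (cong₂ _-_ (a≡e+bM i) (sym (e≗e′ i))) (cancel (e i) (vecMatM k b i))

coprimeTo1 : ∀ n → Coprime n 1
coprimeTo1 n = Cop.sym (1-coprimeTo n)

ℤ→ℚ≡mkℚ : ∀ z → ℤ→ℚ z ≡ mkℚ z 0 (coprimeTo1 ∣ z ∣)
ℤ→ℚ≡mkℚ z = ℚP.↥p/↧p≡p (mkℚ z 0 (coprimeTo1 ∣ z ∣))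

ℤ→ℚ-+ : ∀ a b → ℤ→ℚ (a + b) ≡ ℤ→ℚ a ℚ.+ ℤ→ℚ b
ℤ→ℚ-+ a b = trans (ℚP./-cong {p₁ = a + b} {q₁ = 1} {p₂ = a * + 1 + b * + 1} {q₂ = 1}
                            (sym (cong₂ _+_ (ℤP.*-identityʳ a) (ℤP.*-identityʳ b))) refl)
                  (sym (cong₂ ℚ._+_ (ℤ→ℚ≡mkℚ a) (ℤ→ℚ≡mkℚ b)))

ℤ→ℚ-neg : ∀ a → ℤ→ℚ (- a) ≡ ℚ.- ℤ→ℚ a
ℤ→ℚ-neg a = trans (ℤ→ℚ≡mkℚ (- a)) (trans (neg-mkℚ a) (cong ℚ.-_ (sym (ℤ→ℚ≡mkℚ a))))
  where
  neg-mkℚ : ∀ a → mkℚ (- a) 0 (coprimeTo1 ∣ - a ∣) ≡ ℚ.- mkℚ a 0 (coprimeTo1 ∣ a ∣)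
  neg-mkℚ (+ zero)  = refl
  neg-mkℚ (+ suc n) = refl
  neg-mkℚ -[1+ n ]  = refl

ℤ→ℚ-- : ∀ a b → ℤ→ℚ (a - b) ≡ ℤ→ℚ a ℚ.- ℤ→ℚ b
ℤ→ℚ-- a b = trans (ℤ→ℚ-+ a (- b)) (cong (ℤ→ℚ a ℚ.+_) (ℤ→ℚ-neg b))

ℤ→ℚ-mono-≤ : ∀ {a b} → a ≤ b → ℤ→ℚ a ℚ.≤ ℤ→ℚ b
ℤ→ℚ-mono-≤ {a} {b} a≤b = subst₂ ℚ._≤_ (sym (ℤ→ℚ≡mkℚ a)) (sym (ℤ→ℚ≡mkℚ b))
  (*≤* (subst₂ _≤_ (sym (ℤP.*-identityʳ a)) (sym (ℤP.*-identityʳ b)) a≤b))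

ℤ→ℚ-cancel-≤ : ∀ {a b} → ℤ→ℚ a ℚ.≤ ℤ→ℚ b → a ≤ b
ℤ→ℚ-cancel-≤ {a} {b} p with subst₂ ℚ._≤_ (ℤ→ℚ≡mkℚ a) (ℤ→ℚ≡mkℚ b) p
... | *≤* a*1≤b*1 = subst₂ _≤_ (ℤP.*-identityʳ a) (ℤP.*-identityʳ b) a*1≤b*1

weightSum≤combPoint : ∀ {d} (cs : Comb d) → All NonNegW cs → ∀ j → weightSum cs ℚ.≤ combPoint cs j
weightSum≤combPoint List.[]             All.[]            j = ℚP.≤-refl
weightSum≤combPoint ((l , σ) List.∷ cs) (0≤l All.∷ 0≤ls) j = ℚP.+-mono-≤
  (subst (ℚ._≤ l ℚ.* vertex _ σ j) (ℚP.*-identityʳ l)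
         (ℚP.*-monoˡ-≤-nonNeg l {{ℚ.nonNegative 0≤l}}
           (ℤ→ℚ-mono-≤ {b = + suc (toℕ (σ ⟨$⟩ʳ j))} (+≤+ (s≤s z≤n)))))
  (weightSum≤combPoint cs 0≤ls j)

InPerm-≥1 : ∀ {d} {y : Fin (suc d) → ℚ} → InPerm d y → ∀ j → 1ℚ ℚ.≤ y j
InPerm-≥1 (cs , 0≤ls , ∑l≡1 , y≡) j = subst₂ ℚ._≤_ ∑l≡1 (sym (y≡ j)) (weightSum≤combPoint cs 0≤ls j)

InPerm-resp-≗ : ∀ {d} {y y′ : Fin (suc d) → ℚ} → y ≗ y′ → InPerm d y → InPerm d y′
InPerm-resp-≗ y≗y′ (cs , 0≤ls , ∑l≡1 , y≡) = cs , 0≤ls , ∑l≡1 , λ j → trans (sym (y≗y′ j)) (y≡ j)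

InTile-resp-≗ : ∀ {d} {v : Fin (suc d) → ℤ} {x y} → x ≗ y → InTile d v x → InTile d v y
InTile-resp-≗ {v = v} x≗y = InPerm-resp-≗ (λ j → cong (ℚ._- ℤ→ℚ (v j)) (x≗y j))

vertex-InPerm : ∀ d σ → InPerm d (vertex d σ)
vertex-InPerm d σ = List.[ 1ℚ , σ ] , *≤* (+≤+ z≤n) All.∷ All.[] , ℚP.+-identityʳ 1ℚ ,
  λ j → sym (trans (ℚP.+-identityʳ _) (ℚP.*-identityˡ _))

-- the vertex of Perm_d whose j-th coordinate is 1
cornerVertex : ∀ {d} → Fin (suc d) → Fin (suc d) → ℤ
cornerVertex j m = + suc (toℕ (transpose j zero ⟨$⟩ʳ m))

cornerVertex-self : ∀ {d} (j : Fin (suc d)) → cornerVertex j j ≡ + 1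
cornerVertex-self j with j ≟ j
... | yes _  = refl
... | no j≢j = ⊥-elim (j≢j refl)

cornerVertex-InTile : ∀ {d} j (u : Fin (suc d) → ℤ) → InTile d u (λ m → ℤ→ℚ (cornerVertex j m + u m))
cornerVertex-InTile {d} j u = InPerm-resp-≗ shifted (vertex-InPerm d (transpose j zero))
  where
  cancel : ∀ c u → c ≡ c + u - u
  cancel = solve-∀
  shifted : ∀ m → vertex d (transpose j zero) m ≡ ℤ→ℚ (cornerVertex j m + u m) ℚ.- ℤ→ℚ (u m)
  shifted m = trans (cong ℤ→ℚ (cancel (cornerVertex j m) (u m))) (ℤ→ℚ-- (cornerVertex j m + u m) (u m))

-- Points of Perm_d have all coordinates ≥ 1, and cornerVertex j attains 1 in coordinate j.
cornerVertex-InTile⇒≤ : ∀ {d} j (u u′ : Fin (suc d) → ℤ) →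
                        InTile d u′ (λ m → ℤ→ℚ (cornerVertex j m + u m)) → u′ j ≤ u j
cornerVertex-InTile⇒≤ j u u′ inTile = ℤP.0≤i-j⇒j≤i (subst (+ 0 ≤_) (drop1 (u j) (u′ j))
  (ℤP.i≤j⇒0≤j-i (subst (λ c → + 1 ≤ c + u j - u′ j) (cornerVertex-self j) 1≤coordinate)))
  where
  drop1 : ∀ u u′ → + 1 + u - u′ - + 1 ≡ u - u′
  drop1 = solve-∀
  1≤coordinate : + 1 ≤ cornerVertex j j + u j - u′ j
  1≤coordinate = ℤ→ℚ-cancel-≤ {+ 1}
    (subst (1ℚ ℚ.≤_) (sym (ℤ→ℚ-- (cornerVertex j j + u j) (u′ j))) (InPerm-≥1 inTile j))

tile-translation : ∀ d (v v′ : Fin (suc d) → ℤ) x →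
                   InTile d v x ⇔ InTile d v′ (λ j → x j ℚ.+ ℤ→ℚ (v′ j - v j))
tile-translation d v v′ x = mk⇔ (InPerm-resp-≗ (sym ∘ translated)) (InPerm-resp-≗ translated)
  where
  cancel : ∀ v v′ → v′ - v - v′ ≡ - v
  cancel = solve-∀
  translated : ∀ j → x j ℚ.+ ℤ→ℚ (v′ j - v j) ℚ.- ℤ→ℚ (v′ j) ≡ x j ℚ.- ℤ→ℚ (v j)
  translated j = begin
    x j ℚ.+ ℤ→ℚ (v′ j - v j) ℚ.- ℤ→ℚ (v′ j)     ≡⟨ ℚP.+-assoc (x j) _ _ ⟩
    x j ℚ.+ (ℤ→ℚ (v′ j - v j) ℚ.- ℤ→ℚ (v′ j))   ≡⟨ cong (x j ℚ.+_) (ℤ→ℚ-- (v′ j - v j) (v′ j)) ⟨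
    x j ℚ.+ ℤ→ℚ (v′ j - v j - v′ j)             ≡⟨ cong (λ z → x j ℚ.+ ℤ→ℚ z) (cancel (v j) (v′ j)) ⟩
    x j ℚ.+ ℤ→ℚ (- v j)                         ≡⟨ cong (x j ℚ.+_) (ℤ→ℚ-neg (v j)) ⟩
    x j ℚ.- ℤ→ℚ (v j)                           ∎
    where open ≡-Reasoning

tile-translation-unique : ∀ d (v v′ ℓ : Fin (suc d) → ℤ) →
                          (∀ x → InTile d v x ⇔ InTile d v′ (λ j → x j ℚ.+ ℤ→ℚ (ℓ j))) →
                          ∀ j → v′ j ≡ v j + ℓ j
tile-translation-unique d v v′ ℓ v↦v′ j = ℤP.≤-antisym v′≤v+ℓ v+ℓ≤v′
  where
  corner : (Fin (suc d) → ℤ) → Fin (suc d) → ℚ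
  corner u m = ℤ→ℚ (cornerVertex j m + u m)
  shift : ∀ c u ℓ → c + u + ℓ ≡ c + (u + ℓ)
  shift = solve-∀
  corner-+ : ∀ u m → corner u m ℚ.+ ℤ→ℚ (ℓ m) ≡ corner (λ i → u i + ℓ i) m
  corner-+ u m =
    trans (sym (ℤ→ℚ-+ (cornerVertex j m + u m) (ℓ m))) (cong ℤ→ℚ (shift (cornerVertex j m) (u m) (ℓ m)))
  v′≤v+ℓ : v′ j ≤ v j + ℓ j
  v′≤v+ℓ = cornerVertex-InTile⇒≤ j (λ m → v m + ℓ m) v′
    (InTile-resp-≗ {v = v′} {x = λ m → corner v m ℚ.+ ℤ→ℚ (ℓ m)} (corner-+ v)
                   (Equivalence.to (v↦v′ (corner v)) (cornerVertex-InTile j v)))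
  v′-ℓ : Fin (suc d) → ℤ
  v′-ℓ m = v′ m - ℓ m
  restore : ∀ u ℓ → u - ℓ + ℓ ≡ u
  restore = solve-∀
  v≤v′-ℓ : v j ≤ v′ j - ℓ j
  v≤v′-ℓ = cornerVertex-InTile⇒≤ j v′-ℓ v (Equivalence.from (v↦v′ (corner v′-ℓ))
    (InTile-resp-≗ {v = v′} {x = corner v′} {y = λ m → corner v′-ℓ m ℚ.+ ℤ→ℚ (ℓ m)} restored
                   (cornerVertex-InTile j v′)))
    where
    restored : ∀ m → corner v′ m ≡ corner v′-ℓ m ℚ.+ ℤ→ℚ (ℓ m)
    restored m = sym (trans (corner-+ v′-ℓ m) (cong (λ u → ℤ→ℚ (cornerVertex j m + u)) (restore (v′ m) (ℓ m))))
  v+ℓ≤v′ : v j + ℓ j ≤ v′ j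
  v+ℓ≤v′ = subst (v j + ℓ j ≤_) (restore (v′ j) (ℓ j)) (ℤP.+-monoˡ-≤ (ℓ j) v≤v′-ℓ)

tileEquiv⇒congL : ∀ d k {v v′ : Fin (suc d) → ℤ} → TileEquiv d k v v′ → CongL d k v v′
tileEquiv⇒congL d k {v} {v′} (ℓ , ℓ∈L , v↦v′) =
  InL-resp-≗ d k {x = λ j → - ℓ j} difference (InL-neg d k ℓ∈L)
  where
  cancel : ∀ v ℓ → - ℓ ≡ v - (v + ℓ)
  cancel = solve-∀
  difference : ∀ j → - ℓ j ≡ v j - v′ j
  difference j = trans (cancel (v j) (ℓ j)) (cong (_-_ (v j)) (sym (tile-translation-unique d v v′ ℓ v↦v′ j)))

congL⇒tileEquiv : ∀ d k {v v′ : Fin (suc d) → ℤ} → CongL d k v v′ → TileEquiv d k v v′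
congL⇒tileEquiv d k {v} {v′} v-v′∈L =
  (λ j → v′ j - v j) ,
  InL-resp-≗ d k {x = λ j → - (v j - v′ j)} (λ j → swap (v j) (v′ j)) (InL-neg d k v-v′∈L) ,
  tile-translation d v v′
  where
  swap : ∀ v v′ → - (v - v′) ≡ v′ - v
  swap = solve-∀

lemma4p10 : (d : ℕ) → 2 ℕ.≤ d → (k : Fin (suc d) → ℕ) → (∀ i → 1 ℕ.≤ k i) →
    ∃ λ (N : ℕ) →
    HasNClasses (InΛ d) (CongL d k) N ×
    HasNClasses (InΛ d) (TileEquiv d k) N ×
    + N ≡ det (M d k) ×
    det (M d k) ≡ prodℤ (λ i → + suc (k i)) - prodℤ (λ i → + k i)
lemma4p10 (suc (suc d₀)) (s≤s (s≤s z≤n)) k _ =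
  normalFormCount k , Λ/L , tiles/L , trans (normalFormCount-formula k) (sym (det-M d₀ k)) , det-M d₀ k
  where
  d = suc (suc d₀)
  Λ/L : Classes (InΛ d) (CongL d k) (Fin (normalFormCount k))
  Λ/L = Classes-map _≗_ {_≈_ = CongL d k} (combW d) (λ {e} _ → e , λ _ → refl)
                    (congL-normalForm-unique k) (InΛ-normalForm k) (normalForm-classes k)
  tiles/L : Classes (InΛ d) (TileEquiv d k) (Fin (normalFormCount k))
  tiles/L = Classes-map (CongL d k) {_≈_ = TileEquiv d k} id id (λ {x} {y} _ _ → tileEquiv⇒congL d k {x} {y})
                    (λ {v} v∈Λ → v , v∈Λ , λ {v′} → congL⇒tileEquiv d k {v} {v′}) Λ/L
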